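{- Let $n,s,k \in \mathbb{N}$ with $n \geqslant 13k - 15$. Then $m(n,2s,s,k) \geqslant n - 2k + 2$.
   Context: An $r$-colouring of the complete graph $K_n$ ($n \geqslant 2$) is any function $f: E(K_n) \to [r] = \{1,\dots,r\}$. For a subgraph $H \subseteq K_n$, $c_f(H) = |f(E(H))|$ is the number of distinct colours on edges of $H$. A graph on at least $k+1$ vertices is $k$-connected if deleting any at most $k-1$ vertices leaves a connected graph. $M(f,n,r,s,k)$ is the maximum number of vertices of a $k$-connected subgraph $H \subseteq K_n$ with $c_f(H) \leqslant s$ (taken to be $0$ if no such subgraph exists), and $m(n,r,s,k) = \min_f M(f,n,r,s,k)$, the minimum over all $r$-colourings $f$ of $E(K_n)$. -}

module Defs where

open import Data.Nat using (ℕ; zero; suc; _+_; _≤_)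
open import Data.Bool using (Bool; true; false; _∧_; _∨_)
open import Data.Fin using (Fin; zero; suc; _≟_)
open import Data.Fin.Subset using (Subset; _∈_; _⊆_; _─_; ∣_∣)
open import Data.Vec using (tabulate)
open import Relation.Binary.PropositionalEquality using (_≡_; _≢_)
open import Relation.Nullary.Decidable using (⌊_⌋)
open import Data.Product using (_×_)

-- The colour of the edge {i,j} (i ≠ j) is f i j; colourings are required
-- to be symmetric (values on the diagonal are irrelevant).
Colouring : ℕ → ℕ → Set
Colouring n r = Fin n → Fin n → Fin r

SymmetricColouring : ∀ {n r} → Colouring n r → Set
SymmetricColouring f = ∀ i j → f i j ≡ f j i

record Subgraph (n : ℕ) : Set where
  field
    V      : Subset n
    E      : Fin n → Fin n → Bool
    E-sym  : ∀ i j → E i j ≡ E j i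
    E-irr  : ∀ i → E i i ≡ false
    E-inV  : ∀ i j → E i j ≡ true → i ∈ V
open Subgraph public

data Walk {n : ℕ} (H : Subgraph n) (W : Subset n) : Fin n → Fin n → Set where
  here : ∀ {u} → u ∈ W → Walk H W u u
  step : ∀ {u v w} → u ∈ W → E H u v ≡ true → Walk H W v w → Walk H W u w

ConnectedAfterDeleting : ∀ {n} → Subgraph n → Subset n → Set
ConnectedAfterDeleting H S =
  ∀ u v → u ∈ (V H ─ S) → v ∈ (V H ─ S) → Walk H (V H ─ S) u v

KConnected : ∀ {n} → ℕ → Subgraph n → Set
KConnected k H =
  suc k ≤ ∣ V H ∣ ×
  (∀ (S : Subset _) → S ⊆ V H → ∣ S ∣ + 1 ≤ k → ConnectedAfterDeleting H S)

anyFin : ∀ {n} → (Fin n → Bool) → Bool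
anyFin {zero}  p = false
anyFin {suc n} p = p zero ∨ anyFin (λ i → p (suc i))

colourSet : ∀ {n r} → Colouring n r → Subgraph n → Subset r
colourSet f H = tabulate λ c →
  anyFin λ i → anyFin λ j → E H i j ∧ ⌊ f i j ≟ c ⌋

numColours : ∀ {n r} → Colouring n r → Subgraph n → ℕ
numColours f H = ∣ colourSet f H ∣

-- Split the 2s colours into the s colours below s ("red") and the s colours from s on ("blue");
-- it suffices to find a red or a blue k-connected subgraph on n - 2k + 2 vertices.  Write
-- k = ℓ + 1 and shrink a vertex set W, starting from all vertices, so that at most 2ℓ vertices
-- lie outside W and each of them has at most ℓ red neighbours in W.  If the red graph on W is not
-- k-connected, some set S of at most ℓ vertices splits W - S into parts A and B with no red edge
-- between them.  If both parts have more than ℓ vertices, the blue graph outside S is k-connected: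
-- vertices in different parts are blue neighbours, two vertices of the same part have the whole
-- other part as common blue neighbours, and a vertex outside W sees more than ℓ vertices of W - S
-- in blue.  Otherwise the small part is removed from W, which preserves the invariant until
-- between 2ℓ + 1 and 3ℓ vertices D have been removed.  Counting the red edges between D and W
-- twice shows that at most 2ℓ vertices X of W have |D| - ℓ or more red neighbours in D, and the
-- blue graph outside X is k-connected around the core D.  In both cases k-connectivity follows
-- from a core P: every vertex lies in P or has k neighbours in P, and any two vertices of P are
-- adjacent or have k common neighbours.

module Submission where

open import Defs
open import Data.Bool.Base using (Bool; true; false; not; _∧_)
open import Data.Bool.Properties using (∧-comm; ∧-zeroʳ; ∧-conicalˡ; ∧-conicalʳ; not-injective)
import Data.Bool.Properties as Bool
open import Data.Fin.Base using (Fin; zero; suc; toℕ)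
open import Data.Fin.Properties using (_≟_; any?)
open import Data.Fin.Subset
open import Data.Fin.Subset.Properties
open import Data.Fin.Subset.Induction using (⊂-wellFounded; ⊃-wellFounded)
open import Data.List.Base using (_∷_; [])
open import Data.Nat.Base using (ℕ; zero; suc; _+_; _*_; _∸_; _≤_; _<_; _⊓_; _<ᵇ_; s≤s; z≤n)
open import Data.Nat.Properties
  using ( +-*-semiring; _<?_; _≤?_; module ≤-Reasoning
        ; ≤-reflexive; ≤-trans; ≤-pred; <-≤-trans; ≤-<-trans; <⇒≤; <⇒≱; ≰⇒>; n≤1+n; n<1+n
        ; +-comm; +-assoc; +-suc; +-identityʳ; *-identityˡ; ⊓-zeroʳ; m≥n⇒m⊓n≡n
        ; +-mono-≤; +-monoˡ-≤; +-monoʳ-≤; *-monoˡ-≤; +-cancelˡ-≤; +-cancelʳ-≤; *-cancelʳ-<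
        ; m≤m+n; m≤n*m; m≤n⇒∃[o]m+o≡n; m∸n+n≡m; m+[n∸m]≡n; m+n∸m≡n )
open import Data.Nat.Tactic.RingSolver using (solve)
open import Algebra.Properties.Semiring.Sum +-*-semiring
  using (sum; sum-syntax; ∑-comm; sum-cong-≗; sum-replicate-zero; *-distribʳ-sum)
open import Data.Product.Base using (Σ; ∃; ∃₂; _×_; _,_; proj₁; proj₂)
open import Data.Sum.Base using (_⊎_; inj₁; inj₂; [_,_]′)
import Data.Sum.Base as Sum
open import Data.Vec.Base using (here; there; lookup; tabulate)
import Data.Vec.Base as Vec
open import Data.Vec.Properties using (lookup∘tabulate; []=⇒lookup; lookup⇒[]=; lookup-zipWith)
open import Function.Base using (id; _∘_)
open import Function.Bundles using (mk⇔)
open import Induction.WellFounded using (Acc; acc)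
open import Relation.Binary.PropositionalEquality
open import Relation.Nullary.Decidable using (Dec; yes; no; does; ⌊_⌋; dec-true; does-⇔; _×-dec_; ¬?)
open import Relation.Nullary.Negation using (¬_; contradiction)
open import Relation.Unary using (Decidable)

private variable
  n : ℕ
  i j x y : Fin n
  p q r W : Subset n

-- Subsets of Fin n

x∈p─q⇒x∉q : x ∈ p ─ q → x ∉ q
x∈p─q⇒x∉q {p = _       Vec.∷ p} {_      Vec.∷ q} (there x∈p─q) (there x∈q) = x∈p─q⇒x∉q x∈p─q x∈q
x∈p─q⇒x∉q {p = inside  Vec.∷ p} {inside Vec.∷ q} () here
x∈p─q⇒x∉q {p = outside Vec.∷ p} {inside Vec.∷ q} () here

∁∁p⊆p : ∁ (∁ p) ⊆ p
∁∁p⊆p x∈∁∁p = x∉∁p⇒x∈p (x∈∁p⇒x∉p x∈∁∁p)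

∣p∣+∣∁p∣≡n : ∀ (p : Subset n) → ∣ p ∣ + ∣ ∁ p ∣ ≡ n
∣p∣+∣∁p∣≡n p = trans (cong (∣ p ∣ +_) (∣∁p∣≡n∸∣p∣ p)) (m+[n∸m]≡n (∣p∣≤n p))

∣p∪q∣≤∣p∣+∣q∣ : ∀ (p q : Subset n) → ∣ p ∪ q ∣ ≤ ∣ p ∣ + ∣ q ∣
∣p∪q∣≤∣p∣+∣q∣ Vec.[]            Vec.[]            = z≤n
∣p∪q∣≤∣p∣+∣q∣ (outside Vec.∷ p) (outside Vec.∷ q) = ∣p∪q∣≤∣p∣+∣q∣ p q
∣p∪q∣≤∣p∣+∣q∣ (outside Vec.∷ p) (inside  Vec.∷ q) =
  ≤-trans (s≤s (∣p∪q∣≤∣p∣+∣q∣ p q)) (≤-reflexive (sym (+-suc ∣ p ∣ ∣ q ∣)))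
∣p∪q∣≤∣p∣+∣q∣ (inside  Vec.∷ p) (outside Vec.∷ q) = s≤s (∣p∪q∣≤∣p∣+∣q∣ p q)
∣p∪q∣≤∣p∣+∣q∣ (inside  Vec.∷ p) (inside  Vec.∷ q) = s≤s (≤-trans (∣p∪q∣≤∣p∣+∣q∣ p q) (+-monoʳ-≤ ∣ p ∣ (n≤1+n ∣ q ∣)))

p⊆q∪r⇒∣p∣≤∣q∣+∣r∣ : p ⊆ q ∪ r → ∣ p ∣ ≤ ∣ q ∣ + ∣ r ∣
p⊆q∪r⇒∣p∣≤∣q∣+∣r∣ {q = q} {r} p⊆q∪r = ≤-trans (p⊆q⇒∣p∣≤∣q∣ p⊆q∪r) (∣p∪q∣≤∣p∣+∣q∣ q r)

∣p∣<∣q∣⇒∃x∈q─p : ∣ p ∣ < ∣ q ∣ → ∃ λ x → x ∈ q × x ∉ p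
∣p∣<∣q∣⇒∃x∈q─p {p = p} {q = q} ∣p∣<∣q∣ with nonempty? (q ─ p)
... | yes (x , x∈q─p) = x , p─q⊆p q p x∈q─p , x∈p─q⇒x∉q x∈q─p
... | no  q─p-empty  = contradiction (p⊆q⇒∣p∣≤∣q∣ q⊆p) (<⇒≱ ∣p∣<∣q∣)
  where
  q⊆p : q ⊆ p
  q⊆p {x} x∈q with x ∈? p
  ... | yes x∈p = x∈p
  ... | no  x∉p = contradiction (x , x∈p∧x∉q⇒x∈p─q x∈q x∉p) q─p-empty

∣p∣≤∣q∣+∣p─q∣ : ∀ (p q : Subset n) → ∣ p ∣ ≤ ∣ q ∣ + ∣ p ─ q ∣
∣p∣≤∣q∣+∣p─q∣ p q = p⊆q∪r⇒∣p∣≤∣q∣+∣r∣ split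
  where
  split : p ⊆ q ∪ (p ─ q)
  split {x} x∈p with x ∈? q
  ... | yes x∈q = x∈p∪q⁺ (inj₁ x∈q)
  ... | no  x∉q = x∈p∪q⁺ (inj₂ (x∈p∧x∉q⇒x∈p─q x∈p x∉q))

∣∁[p─q]∣≤∣∁p∣+∣q∣ : ∀ (p q : Subset n) → ∣ ∁ (p ─ q) ∣ ≤ ∣ ∁ p ∣ + ∣ q ∣
∣∁[p─q]∣≤∣∁p∣+∣q∣ p q = p⊆q∪r⇒∣p∣≤∣q∣+∣r∣ split
  where
  split : ∁ (p ─ q) ⊆ ∁ p ∪ q
  split {x} x∈∁[p─q] with x ∈? p | x ∈? q
  ... | _       | yes x∈q = x∈p∪q⁺ (inj₂ x∈q)
  ... | no  x∉p | no  _   = x∈p∪q⁺ (inj₁ (x∉p⇒x∈∁p x∉p))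
  ... | yes x∈p | no  x∉q = contradiction (x∈p∧x∉q⇒x∈p─q x∈p x∉q) (x∈∁p⇒x∉p x∈∁[p─q])

p⊆q⇒∣p∩r∣≤∣q∩r∣ : ∀ {p q : Subset n} r → p ⊆ q → ∣ p ∩ r ∣ ≤ ∣ q ∩ r ∣
p⊆q⇒∣p∩r∣≤∣q∩r∣ {p = p} {q} r p⊆q = p⊆q⇒∣p∣≤∣q∣ λ x∈p∩r →
  let x∈p , x∈r = x∈p∩q⁻ p r x∈p∩r in x∈p∩q⁺ (p⊆q x∈p , x∈r)

x∈tabulate⁺ : ∀ {f : Fin n → Bool} {x} → f x ≡ true → x ∈ tabulate f
x∈tabulate⁺ {f = f} {x = x} fx = lookup⇒[]= x (tabulate f) (trans (lookup∘tabulate f x) fx)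

x∈tabulate⁻ : ∀ {f : Fin n → Bool} {x} → x ∈ tabulate f → f x ≡ true
x∈tabulate⁻ {f = f} {x = x} x∈ = trans (sym (lookup∘tabulate f x)) ([]=⇒lookup x∈)

module _ {P : Fin n → Set} (P? : Decidable P) where

  toSubset : Subset n
  toSubset = tabulate (does ∘ P?)

  ∈toSubset⁺ : P x → x ∈ toSubset
  ∈toSubset⁺ {x} Px = x∈tabulate⁺ (dec-true (P? x) Px)

  ∈toSubset⁻ : x ∈ toSubset → P x
  ∈toSubset⁻ {x} x∈ with P? x | x∈tabulate⁻ x∈
  ... | yes Px | _ = Px

-- Graphs on Fin n

record Graph (n : ℕ) : Set where
  field
    adj        : Fin n → Fin n → Bool
    adj-sym    : ∀ i j → adj i j ≡ adj j i
    adj-irrefl : ∀ i → adj i i ≡ false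
open Graph public

loopless : (R : Fin n → Fin n → Bool) → (∀ i j → R i j ≡ R j i) → Graph n
loopless R R-sym = record
  { adj        = λ i j → not (does (i ≟ j)) ∧ R i j
  ; adj-sym    = λ i j → cong₂ (λ b c → not b ∧ c) (does-⇔ (mk⇔ sym sym) (i ≟ j) (j ≟ i)) (R-sym i j)
  ; adj-irrefl = λ i → cong (λ b → not b ∧ R i i) (dec-true (i ≟ i) refl)
  }

loopless-adj⁺ : ∀ R R-sym → i ≢ j → R i j ≡ true → adj (loopless R R-sym) i j ≡ true
loopless-adj⁺ {i = i} {j} R _ i≢j Rij with i ≟ j
... | yes i≡j = contradiction i≡j i≢j
... | no  _   = Rij

adj⇒≢ : ∀ (G : Graph n) → adj G i j ≡ true → i ≢ j
adj⇒≢ {i = i} G Gij refl = Bool.not-¬ Gij (adj-irrefl G i)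

complement : Graph n → Graph n
complement G = loopless (λ i j → not (adj G i j)) (λ i j → cong not (adj-sym G i j))

module _ {G : Graph n} where

  complement-adj⁺ : i ≢ j → adj G i j ≡ false → adj (complement G) i j ≡ true
  complement-adj⁺ {i = i} {j} i≢j Gij with i ≟ j
  ... | yes i≡j = contradiction i≡j i≢j
  ... | no  _   = cong not Gij

  complement-adj⁻ : adj (complement G) i j ≡ true → adj G i j ≡ false
  complement-adj⁻ e = not-injective (∧-conicalʳ _ _ e)

-- Opaque so that the graph can be inferred from a membership proof y ∈ N G x.
opaque
  N : Graph n → Fin n → Subset n
  N G x = tabulate (adj G x)

module _ {G : Graph n} where
  opaque
    unfolding N

    ∈N⁺ : adj G x y ≡ true → y ∈ N G x
    ∈N⁺ = x∈tabulate⁺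

    ∈N⁻ : y ∈ N G x → adj G x y ≡ true
    ∈N⁻ = x∈tabulate⁻

    lookup-N : ∀ x y → lookup (N G x) y ≡ adj G x y
    lookup-N x = lookup∘tabulate (adj G x)

  ∉N⁺ : adj G x y ≡ false → y ∉ N G x
  ∉N⁺ Gxy y∈N = Bool.not-¬ (∈N⁻ y∈N) Gxy

  ∈N-sym : y ∈ N G x → x ∈ N G y
  ∈N-sym {y = y} {x} y∈N = ∈N⁺ (trans (adj-sym G y x) (∈N⁻ y∈N))

module _ {G : Graph n} where

  ∉N⇒∈N-complement : x ≢ y → y ∉ N G x → y ∈ N (complement G) x
  ∉N⇒∈N-complement x≢y y∉N = ∈N⁺ (complement-adj⁺ {G = G} x≢y (Bool.¬-not (y∉N ∘ ∈N⁺)))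

  ∣p∣≤∣p∩N∣+∣p∩N-complement∣ : ∀ {p} → x ∉ p → ∣ p ∣ ≤ ∣ p ∩ N G x ∣ + ∣ p ∩ N (complement G) x ∣
  ∣p∣≤∣p∩N∣+∣p∩N-complement∣ {x = x} {p} x∉p = p⊆q∪r⇒∣p∣≤∣q∣+∣r∣ split
    where
    split : p ⊆ p ∩ N G x ∪ p ∩ N (complement G) x
    split {y} y∈p with y ∈? N G x
    ... | yes y∈N = x∈p∪q⁺ (inj₁ (x∈p∩q⁺ (y∈p , y∈N)))
    ... | no  y∉N = x∈p∪q⁺ (inj₂ (x∈p∩q⁺ (y∈p , ∉N⇒∈N-complement (λ { refl → x∉p y∈p }) y∉N)))

induced : Graph n → Subset n → Subgraph n
induced G W = record
  { V     = W
  ; E     = λ i j → (lookup W i ∧ lookup W j) ∧ adj G i j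
  ; E-sym = λ i j → cong₂ _∧_ (∧-comm (lookup W i) (lookup W j)) (adj-sym G i j)
  ; E-irr = λ i → trans (cong (_ ∧_) (adj-irrefl G i)) (∧-zeroʳ _)
  ; E-inV = λ i j e → lookup⇒[]= i W (∧-conicalˡ _ _ (∧-conicalˡ _ _ e))
  }

induced-edge⁻ : ∀ G W → E (induced G W) i j ≡ true → adj G i j ≡ true
induced-edge⁻ _ _ = ∧-conicalʳ _ _

module _ {G : Graph n} where

  induced-edge⁺ : i ∈ W → j ∈ W → adj G i j ≡ true → E (induced G W) i j ≡ true
  induced-edge⁺ i∈W j∈W Gij rewrite []=⇒lookup i∈W | []=⇒lookup j∈W = Gij

-- Walks and connected components

module _ {H : Subgraph n} {U : Subset n} where

  walk-start∈ : ∀ {u v} → Walk H U u v → u ∈ U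
  walk-start∈ (here u∈U)     = u∈U
  walk-start∈ (step u∈U _ _) = u∈U

  walk-++ : ∀ {u v w} → Walk H U u v → Walk H U v w → Walk H U u w
  walk-++ (here _)       q = q
  walk-++ (step u∈U e p) q = step u∈U e (walk-++ p q)

  walk-reverse : ∀ {u v} → Walk H U u v → Walk H U v u
  walk-reverse (here u∈U)     = here u∈U
  walk-reverse (step u∈U e p) =
    walk-++ (walk-reverse p) (step (walk-start∈ p) (trans (E-sym H _ _) e) (here u∈U))

module Component (H : Subgraph n) (U : Subset n) (u : Fin n) where

  Reached : Subset n → Set
  Reached T = T ⊆ U × (∀ {v} → v ∈ T → Walk H U u v)

  Closed : Subset n → Set
  Closed T = ∀ {a b} → a ∈ T → b ∈ U → E H a b ≡ true → b ∈ T

  saturate : ∀ T → Acc _⊃_ T → Reached T → ∃ λ T′ → Reached T′ × T ⊆ T′ × Closed T′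
  saturate T (acc larger) (T⊆U , reach)
    with any? (λ b → any? (λ a → b ∈? U ×-dec ¬? (b ∈? T) ×-dec a ∈? T ×-dec E H a b Bool.≟ true))
  ... | no none = T , (T⊆U , reach) , id , closed
    where
    closed : Closed T
    closed {a} {b} a∈T b∈U e with b ∈? T
    ... | yes b∈T = b∈T
    ... | no  b∉T = contradiction (b , a , b∈U , b∉T , a∈T , e) none
  ... | yes (b , a , b∈U , b∉T , a∈T , e)
    with saturate (T ∪ ⁅ b ⁆) (larger T⊂T∪b) (T∪b⊆U , reach′)
    where
    T⊂T∪b : T ⊂ T ∪ ⁅ b ⁆
    T⊂T∪b = p⊆p∪q ⁅ b ⁆ , b , x∈p∪q⁺ (inj₂ (x∈⁅x⁆ b)) , b∉T
    T∪b⊆U : T ∪ ⁅ b ⁆ ⊆ U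
    T∪b⊆U v∈ with x∈p∪q⁻ T ⁅ b ⁆ v∈
    ... | inj₁ v∈T = T⊆U v∈T
    ... | inj₂ v∈b rewrite x∈⁅y⁆⇒x≡y b v∈b = b∈U
    reach′ : ∀ {v} → v ∈ T ∪ ⁅ b ⁆ → Walk H U u v
    reach′ v∈ with x∈p∪q⁻ T ⁅ b ⁆ v∈
    ... | inj₁ v∈T = reach v∈T
    ... | inj₂ v∈b rewrite x∈⁅y⁆⇒x≡y b v∈b =
      walk-++ (reach a∈T) (step (T⊆U a∈T) e (here b∈U))
  ... | T′ , reached , T∪b⊆T′ , closed = T′ , reached , T∪b⊆T′ ∘ p⊆p∪q ⁅ b ⁆ , closed

  -- Opaque: unfolding it would make the type checker run the saturation.
  opaque
    saturated : ∃ λ T → Reached T × U ∩ ⁅ u ⁆ ⊆ T × Closed T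
    saturated = saturate (U ∩ ⁅ u ⁆) (⊃-wellFounded _) (proj₁ ∘ x∈p∩q⁻ U ⁅ u ⁆ , start)
      where
      start : ∀ {v} → v ∈ U ∩ ⁅ u ⁆ → Walk H U u v
      start v∈ with x∈p∩q⁻ U ⁅ u ⁆ v∈
      ... | v∈U , v∈u rewrite x∈⁅y⁆⇒x≡y u v∈u = here v∈U

  component : Subset n
  component = proj₁ saturated

  component⊆U : component ⊆ U
  component⊆U = proj₁ (proj₁ (proj₂ saturated))

  component-walk : ∀ {v} → v ∈ component → Walk H U u v
  component-walk = proj₂ (proj₁ (proj₂ saturated))

  start∈component : u ∈ U → u ∈ component
  start∈component u∈U = proj₁ (proj₂ (proj₂ saturated)) (x∈p∩q⁺ (u∈U , x∈⁅x⁆ u))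

  component-closed : Closed component
  component-closed = proj₂ (proj₂ (proj₂ saturated))

-- k-connectivity

module _ (H : Subgraph n) where
  open Component H

  Disconnecting : Subset n → Set
  Disconnecting S =
    ∃₂ λ u v → u ∈ V H ─ S × v ∈ V H ─ S × v ∉ component (V H ─ S) u

  disconnecting? : ∀ S → Dec (Disconnecting S)
  disconnecting? S = any? λ u → any? λ v →
    u ∈? V H ─ S ×-dec v ∈? V H ─ S ×-dec ¬? (v ∈? component (V H ─ S) u)

  ¬disconnecting⇒connected : ∀ {S} → ¬ Disconnecting S → ConnectedAfterDeleting H S
  ¬disconnecting⇒connected {S} ¬disconnecting u v u∈ v∈ with v ∈? component (V H ─ S) u
  ... | yes v∈C = component-walk (V H ─ S) u v∈C
  ... | no  v∉C = contradiction (u , v , u∈ , v∈ , v∉C) ¬disconnecting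

  kConnected-or-disconnecting : ∀ k → suc k ≤ ∣ V H ∣ →
    KConnected k H ⊎ ∃ λ S → ∣ S ∣ < k × Disconnecting S
  kConnected-or-disconnecting k size
    with anySubset? (λ S → ∣ S ∣ <? k ×-dec disconnecting? S)
  ... | yes small-disconnecting = inj₂ small-disconnecting
  ... | no  none = inj₁ (size , λ S _ small → ¬disconnecting⇒connected λ disconnecting →
                                 none (S , subst (_≤ k) (+-comm ∣ S ∣ 1) small , disconnecting))

module _ (G : Graph n) {W P : Subset n} {k : ℕ} where

  kConnected-via-core : suc k ≤ ∣ W ∣ → P ⊆ W →
    (∀ {x} → x ∈ W → x ∈ P ⊎ k ≤ ∣ P ∩ N G x ∣) →
    (∀ {a b} → a ∈ P → b ∈ P → a ≢ b → adj G a b ≡ true ⊎ k ≤ ∣ W ∩ N G a ∩ N G b ∣) →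
    KConnected k (induced G W)
  kConnected-via-core size P⊆W near-core core-linked = size , connected
    where
    connected : ∀ S → S ⊆ W → ∣ S ∣ + 1 ≤ k → ConnectedAfterDeleting (induced G W) S
    connected S _ small u v u∈ v∈ =
      let c , c∈P , c∉S , u⇝c = to-core u∈
          d , d∈P , d∉S , v⇝d = to-core v∈
      in walk-++ u⇝c (walk-++ (between c∈P c∉S d∈P d∉S) (walk-reverse v⇝d))
      where
      H : Subgraph n
      H = induced G W

      W─S : Subset n
      W─S = W ─ S

      avoid : ∀ {Q} → k ≤ ∣ Q ∣ → ∃ λ y → y ∈ Q × y ∉ S
      avoid k≤∣Q∣ = ∣p∣<∣q∣⇒∃x∈q─p (<-≤-trans (subst (_≤ k) (+-comm ∣ S ∣ 1) small) k≤∣Q∣)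

      edge : ∀ {x y} → x ∈ W → y ∈ W → adj G x y ≡ true → E H x y ≡ true
      edge = induced-edge⁺ {G = G}

      keep : ∀ {y} → y ∈ W → y ∉ S → y ∈ W─S
      keep = x∈p∧x∉q⇒x∈p─q

      to-core : ∀ {x} → x ∈ W─S → ∃ λ c → c ∈ P × c ∉ S × Walk H W─S x c
      to-core {x} x∈ with near-core (p─q⊆p W S x∈)
      ... | inj₁ x∈P  = x , x∈P , x∈p─q⇒x∉q x∈ , here x∈
      ... | inj₂ many with avoid many
      ... | c , c∈P∩Nx , c∉S with x∈p∩q⁻ P (N G x) c∈P∩Nx
      ... | c∈P , c∈Nx = c , c∈P , c∉S ,
        step x∈ (edge (p─q⊆p W S x∈) (P⊆W c∈P) (∈N⁻ c∈Nx)) (here (keep (P⊆W c∈P) c∉S))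

      between : ∀ {a b} → a ∈ P → a ∉ S → b ∈ P → b ∉ S → Walk H W─S a b
      between {a} {b} a∈P a∉S b∈P b∉S with a ≟ b
      ... | yes refl = here (keep (P⊆W a∈P) a∉S)
      ... | no  a≢b with core-linked a∈P b∈P a≢b
      ... | inj₁ a~b =
        step (keep (P⊆W a∈P) a∉S) (edge (P⊆W a∈P) (P⊆W b∈P) a~b) (here (keep (P⊆W b∈P) b∉S))
      ... | inj₂ many with avoid many
      ... | z , z∈common , z∉S with x∈p∩q⁻ W _ z∈common
      ... | z∈W , z∈Na∩Nb with x∈p∩q⁻ (N G a) (N G b) z∈Na∩Nb
      ... | z∈Na , z∈Nb =
        step (keep (P⊆W a∈P) a∉S) (edge (P⊆W a∈P) z∈W (∈N⁻ z∈Na))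
          (step (keep z∈W z∉S) (edge z∈W (P⊆W b∈P) (∈N⁻ (∈N-sym z∈Nb))) (here (keep (P⊆W b∈P) b∉S)))

record Separation (k : ℕ) (G : Graph n) (W : Subset n) : Set where
  field
    S A B      : Subset n
    ∣S∣<k      : ∣ S ∣ < k
    A⊆W─S      : A ⊆ W ─ S
    B⊆W─S      : B ⊆ W ─ S
    W─S⊆A∪B    : W ─ S ⊆ A ∪ B
    A-disjoint-B      : ∀ {x} → x ∈ A → x ∉ B
    A-nonempty : Nonempty A
    B-nonempty : Nonempty B
    no-edge    : ∀ {a b} → a ∈ A → b ∈ B → adj G a b ≡ false

  across : ∀ {a b} → a ∈ A → b ∈ B → b ∈ N (complement G) a
  across a∈A b∈B = ∉N⇒∈N-complement (λ { refl → A-disjoint-B a∈A b∈B }) (∉N⁺ {G = G} (no-edge a∈A b∈B))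

  B⊆common-complement-neighbours : ∀ {a b} → a ∈ A → b ∈ A → B ⊆ ∁ S ∩ N (complement G) a ∩ N (complement G) b
  B⊆common-complement-neighbours a∈A b∈A y∈B =
    x∈p∩q⁺ (x∉p⇒x∈∁p (x∈p─q⇒x∉q (B⊆W─S y∈B)) , x∈p∩q⁺ (across a∈A y∈B , across b∈A y∈B))

  swap : Separation k G W
  swap = record
    { S = S ; A = B ; B = A ; ∣S∣<k = ∣S∣<k ; A⊆W─S = B⊆W─S ; B⊆W─S = A⊆W─S
    ; W─S⊆A∪B    = λ x∈ → x∈p∪q⁺ (Sum.swap (x∈p∪q⁻ A B (W─S⊆A∪B x∈)))
    ; A-disjoint-B      = λ x∈B x∈A → A-disjoint-B x∈A x∈B
    ; A-nonempty = B-nonempty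
    ; B-nonempty = A-nonempty
    ; no-edge    = λ {b} {a} b∈B a∈A → trans (adj-sym G b a) (no-edge a∈A b∈B)
    }

module _ (G : Graph n) {W : Subset n} {k : ℕ} where

  separation : ∀ {S} → ∣ S ∣ < k → Disconnecting (induced G W) S → Separation k G W
  separation {S} ∣S∣<k (u , v , u∈ , v∈ , v∉C) = record
    { S = S ; A = C ; B = W ─ S ─ C ; ∣S∣<k = ∣S∣<k
    ; A⊆W─S      = component⊆U
    ; B⊆W─S      = p─q⊆p (W ─ S) C
    ; W─S⊆A∪B    = split
    ; A-disjoint-B      = λ x∈C x∈B → x∈p─q⇒x∉q x∈B x∈C
    ; A-nonempty = u , start∈component u∈
    ; B-nonempty = v , x∈p∧x∉q⇒x∈p─q v∈ v∉C
    ; no-edge    = no-edge-leaving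
    }
    where
    open Component (induced G W) (W ─ S) u

    C : Subset n
    C = component

    no-edge-leaving : ∀ {a b} → a ∈ C → b ∈ W ─ S ─ C → adj G a b ≡ false
    no-edge-leaving {b = b} a∈C b∈B = Bool.¬-not λ a~b → x∈p─q⇒x∉q b∈B
      (component-closed a∈C b∈W─S (induced-edge⁺ {G = G} (p─q⊆p W S (component⊆U a∈C)) (p─q⊆p W S b∈W─S) a~b))
      where
      b∈W─S : b ∈ W ─ S
      b∈W─S = p─q⊆p (W ─ S) C b∈B

    split : W ─ S ⊆ C ∪ (W ─ S ─ C)
    split {x} x∈ with x ∈? C
    ... | yes x∈C = x∈p∪q⁺ (inj₁ x∈C)
    ... | no  x∉C = x∈p∪q⁺ (inj₂ (x∈p∧x∉q⇒x∈p─q x∈ x∉C))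

  kConnected-or-separation : suc k ≤ ∣ W ∣ → KConnected k (induced G W) ⊎ Separation k G W
  kConnected-or-separation size with kConnected-or-disconnecting (induced G W) k size
  ... | inj₁ connected                 = inj₁ connected
  ... | inj₂ (S , small , disconnects) = inj₂ (separation small disconnects)

-- Double counting

indicator : Bool → ℕ
indicator true  = 1
indicator false = 0

∣p∣≡∑ : ∀ (p : Subset n) → ∣ p ∣ ≡ ∑[ i < n ] indicator (lookup p i)
∣p∣≡∑ Vec.[]            = refl
∣p∣≡∑ (inside  Vec.∷ p) = cong (1 +_) (∣p∣≡∑ p)
∣p∣≡∑ (outside Vec.∷ p) = ∣p∣≡∑ p

sum-mono-≤ : ∀ {f g : Fin n → ℕ} → (∀ i → f i ≤ g i) → sum f ≤ sum g
sum-mono-≤ {n = zero}  f≤g = z≤n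
sum-mono-≤ {n = suc n} f≤g = +-mono-≤ (f≤g zero) (sum-mono-≤ (λ i → f≤g (suc i)))

module _ (G : Graph n) {X D : Subset n} {t ℓ : ℕ} where

  private
    ∣p∩N∣≡∑ : ∀ p x → ∣ p ∩ N G x ∣ ≡ ∑[ a < n ] indicator (lookup p a ∧ adj G x a)
    ∣p∩N∣≡∑ p x = trans (∣p∣≡∑ (p ∩ N G x)) (sum-cong-≗ λ a →
      cong indicator (trans (lookup-zipWith _∧_ a p (N G x)) (cong (lookup p a ∧_) (lookup-N x a))))

    edge : Fin n → Fin n → ℕ
    edge x a = indicator (lookup X x ∧ (lookup D a ∧ adj G x a))

  double-counting : (∀ {x} → x ∈ X → t ≤ ∣ D ∩ N G x ∣) → (∀ {a} → a ∈ D → ∣ X ∩ N G a ∣ ≤ ℓ) →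
    ∣ X ∣ * t ≤ ∣ D ∣ * ℓ
  double-counting degX≥t degD≤ℓ = begin
    ∣ X ∣ * t                                  ≡⟨ cong (_* t) (∣p∣≡∑ X) ⟩
    (∑[ x < n ] indicator (lookup X x)) * t    ≡⟨ *-distribʳ-sum t (λ x → indicator (lookup X x)) ⟩
    ∑[ x < n ] (indicator (lookup X x) * t)    ≤⟨ sum-mono-≤ row ⟩
    ∑[ x < n ] ∑[ a < n ] edge x a             ≡⟨ ∑-comm edge ⟩
    ∑[ a < n ] ∑[ x < n ] edge x a             ≤⟨ sum-mono-≤ column ⟩
    ∑[ a < n ] (indicator (lookup D a) * ℓ)    ≡⟨ *-distribʳ-sum ℓ (λ a → indicator (lookup D a)) ⟨
    (∑[ a < n ] indicator (lookup D a)) * ℓ    ≡⟨ cong (_* ℓ) (∣p∣≡∑ D) ⟨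
    ∣ D ∣ * ℓ                                  ∎
    where
    open ≤-Reasoning

    row : ∀ x → indicator (lookup X x) * t ≤ ∑[ a < n ] edge x a
    row x with lookup X x in x∈X
    ... | false = z≤n
    ... | true  = begin
      1 * t                                           ≡⟨ *-identityˡ t ⟩
      t                                               ≤⟨ degX≥t (lookup⇒[]= x X x∈X) ⟩
      ∣ D ∩ N G x ∣                                   ≡⟨ ∣p∩N∣≡∑ D x ⟩
      ∑[ a < n ] indicator (lookup D a ∧ adj G x a)   ∎

    column : ∀ a → ∑[ x < n ] edge x a ≤ indicator (lookup D a) * ℓ
    column a with lookup D a in a∈D
    ... | false = ≤-reflexive (trans (sum-cong-≗ λ x → cong indicator (∧-zeroʳ (lookup X x)))
                                     (sum-replicate-zero n))
    ... | true  = begin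
      ∑[ x < n ] indicator (lookup X x ∧ adj G x a)   ≡⟨ sum-cong-≗ (λ x → cong (λ b → indicator (lookup X x ∧ b)) (adj-sym G x a)) ⟩
      ∑[ x < n ] indicator (lookup X x ∧ adj G a x)   ≡⟨ ∣p∩N∣≡∑ X a ⟨
      ∣ X ∩ N G a ∣                                   ≤⟨ degD≤ℓ (lookup⇒[]= a D a∈D) ⟩
      ℓ                                               ≡⟨ *-identityˡ ℓ ⟨
      1 * ℓ                                           ∎

x*t≤[t+ℓ]*ℓ⇒x≤2ℓ : ∀ {x t ℓ} → ℓ < t → x * t ≤ (t + ℓ) * ℓ → x ≤ 2 * ℓ
x*t≤[t+ℓ]*ℓ⇒x≤2ℓ {x} {t} {ℓ} ℓ<t x*t≤ with m≤n⇒∃[o]m+o≡n ℓ<t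
... | e , refl = ≤-pred (*-cancelʳ-< (suc ℓ + e) x (suc (2 * ℓ)) (≤-<-trans x*t≤ (begin-strict
  (suc ℓ + e + ℓ) * ℓ                                  <⟨ n<1+n _ ⟩
  suc ((suc ℓ + e + ℓ) * ℓ)                            ≤⟨ m≤m+n _ (2 * ℓ + (ℓ * e + e)) ⟩
  suc ((suc ℓ + e + ℓ) * ℓ) + (2 * ℓ + (ℓ * e + e))    ≡⟨ solve (ℓ ∷ e ∷ []) ⟩
  suc (2 * ℓ) * (suc ℓ + e)                            ∎)))
  where open ≤-Reasoning

-- Two-coloured complete graphs

-- The connectivity is suc ℓ (the paper's k is ℓ + 1), and 8ℓ + 2 ≤ n is all that is used of n ≥ 13k - 15.
module BollobasGyarfas {n : ℕ} (ℓ : ℕ) (red : Graph n) (n-large : 8 * ℓ + 2 ≤ n) where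

  blue : Graph n
  blue = complement red

  LargeKConnected : Graph n → Set
  LargeKConnected G = ∃ λ W → KConnected (suc ℓ) (induced G W) × ∣ ∁ W ∣ ≤ 2 * ℓ

  Sparse : Subset n → Set
  Sparse W = ∀ {a} → a ∉ W → ∣ W ∩ N red a ∣ ≤ ℓ

  2ℓ≤3ℓ : 2 * ℓ ≤ 3 * ℓ
  2ℓ≤3ℓ = *-monoˡ-≤ ℓ {2} {3} (s≤s (s≤s z≤n))

  5ℓ+2≤∣W∣ : ∀ {W} → ∣ ∁ W ∣ ≤ 3 * ℓ → 5 * ℓ + 2 ≤ ∣ W ∣
  5ℓ+2≤∣W∣ {W} ∣∁W∣≤3ℓ = +-cancelˡ-≤ (3 * ℓ) _ _ (begin
    3 * ℓ + (5 * ℓ + 2)    ≡⟨ solve (ℓ ∷ []) ⟩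
    8 * ℓ + 2              ≤⟨ n-large ⟩
    n                      ≡⟨ ∣p∣+∣∁p∣≡n W ⟨
    ∣ W ∣ + ∣ ∁ W ∣        ≤⟨ +-monoʳ-≤ ∣ W ∣ ∣∁W∣≤3ℓ ⟩
    ∣ W ∣ + 3 * ℓ          ≡⟨ +-comm ∣ W ∣ (3 * ℓ) ⟩
    3 * ℓ + ∣ W ∣          ∎)
    where open ≤-Reasoning

  ℓ+2≤∣W∣ : ∀ {W} → ∣ ∁ W ∣ ≤ 2 * ℓ → suc (suc ℓ) ≤ ∣ W ∣
  ℓ+2≤∣W∣ {W} ∣∁W∣≤2ℓ = begin
    suc (suc ℓ)    ≡⟨ +-comm 2 ℓ ⟩
    ℓ + 2          ≤⟨ +-monoˡ-≤ 2 (m≤n*m ℓ 5) ⟩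
    5 * ℓ + 2      ≤⟨ 5ℓ+2≤∣W∣ {W} (≤-trans ∣∁W∣≤2ℓ 2ℓ≤3ℓ) ⟩
    ∣ W ∣          ∎
    where open ≤-Reasoning

  blue-of-balanced-separation : ∀ {W} → ∣ ∁ W ∣ ≤ 2 * ℓ → Sparse W → (sep : Separation (suc ℓ) red W) →
    suc ℓ ≤ ∣ Separation.A sep ∣ → suc ℓ ≤ ∣ Separation.B sep ∣ → LargeKConnected blue
  blue-of-balanced-separation {W} few-removed sparse sep ∣A∣>ℓ ∣B∣>ℓ =
    ∁ S , kConnected-via-core blue (ℓ+2≤∣W∣ {∁ S} removed) P⊆∁S near-core core-linked , removed
    where
    open Separation sep

    P : Subset n
    P = W ─ S

    ∣S∣≤ℓ : ∣ S ∣ ≤ ℓ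
    ∣S∣≤ℓ = ≤-pred ∣S∣<k

    removed : ∣ ∁ (∁ S) ∣ ≤ 2 * ℓ
    removed = ≤-trans (p⊆q⇒∣p∣≤∣q∣ (∁∁p⊆p {p = S})) (≤-trans ∣S∣≤ℓ (m≤n*m ℓ 2))

    P⊆∁S : P ⊆ ∁ S
    P⊆∁S = x∉p⇒x∈∁p ∘ x∈p─q⇒x∉q

    near-core : ∀ {x} → x ∈ ∁ S → x ∈ P ⊎ suc ℓ ≤ ∣ P ∩ N blue x ∣
    near-core {x} x∈∁S with x ∈? W
    ... | yes x∈W = inj₁ (x∈p∧x∉q⇒x∈p─q x∈W (x∈∁p⇒x∉p x∈∁S))
    ... | no  x∉W = inj₂ (+-cancelˡ-≤ (ℓ + ℓ) _ _ (begin
      ℓ + ℓ + suc ℓ                                ≤⟨ m≤m+n _ (2 * ℓ + 1) ⟩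
      ℓ + ℓ + suc ℓ + (2 * ℓ + 1)                  ≡⟨ solve (ℓ ∷ []) ⟩
      5 * ℓ + 2                                    ≤⟨ 5ℓ+2≤∣W∣ {W} (≤-trans few-removed 2ℓ≤3ℓ) ⟩
      ∣ W ∣                                        ≤⟨ ∣p∣≤∣q∣+∣p─q∣ W S ⟩
      ∣ S ∣ + ∣ P ∣                                ≤⟨ +-mono-≤ ∣S∣≤ℓ (∣p∣≤∣p∩N∣+∣p∩N-complement∣ (x∉W ∘ p─q⊆p W S)) ⟩
      ℓ + (∣ P ∩ N red x ∣ + ∣ P ∩ N blue x ∣)     ≤⟨ +-monoʳ-≤ ℓ (+-monoˡ-≤ _ ∣P∩Nx∣≤ℓ) ⟩
      ℓ + (ℓ + ∣ P ∩ N blue x ∣)                   ≡⟨ +-assoc ℓ ℓ _ ⟨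
      ℓ + ℓ + ∣ P ∩ N blue x ∣                     ∎))
      where
      open ≤-Reasoning
      ∣P∩Nx∣≤ℓ : ∣ P ∩ N red x ∣ ≤ ℓ
      ∣P∩Nx∣≤ℓ = ≤-trans (p⊆q⇒∣p∩r∣≤∣q∩r∣ (N red x) (p─q⊆p W S)) (sparse x∉W)

    core-linked : ∀ {a b} → a ∈ P → b ∈ P → a ≢ b →
      adj blue a b ≡ true ⊎ suc ℓ ≤ ∣ ∁ S ∩ N blue a ∩ N blue b ∣
    core-linked a∈P b∈P _ with x∈p∪q⁻ A B (W─S⊆A∪B a∈P) | x∈p∪q⁻ A B (W─S⊆A∪B b∈P)
    ... | inj₁ a∈A | inj₂ b∈B = inj₁ (∈N⁻ (across a∈A b∈B))
    ... | inj₂ a∈B | inj₁ b∈A = inj₁ (∈N⁻ (Separation.across swap a∈B b∈A))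
    ... | inj₁ a∈A | inj₁ b∈A = inj₂ (≤-trans ∣B∣>ℓ (p⊆q⇒∣p∣≤∣q∣ (B⊆common-complement-neighbours a∈A b∈A)))
    ... | inj₂ a∈B | inj₂ b∈B =
      inj₂ (≤-trans ∣A∣>ℓ (p⊆q⇒∣p∣≤∣q∣ (Separation.B⊆common-complement-neighbours swap a∈B b∈B)))

  blue-of-moderate-removal : ∀ {W} → Sparse W → 2 * ℓ < ∣ ∁ W ∣ → ∣ ∁ W ∣ ≤ 3 * ℓ → LargeKConnected blue
  blue-of-moderate-removal {W} sparse ∣∁W∣>2ℓ ∣∁W∣≤3ℓ =
    ∁ X , kConnected-via-core blue (ℓ+2≤∣W∣ {∁ X} removed) D⊆∁X near-core core-linked , removed
    where
    D : Subset n
    D = ∁ W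

    -- A vertex of W outside X has fewer than t red, hence more than ℓ blue, neighbours in D.
    t : ℕ
    t = ∣ D ∣ ∸ ℓ

    t+ℓ≡∣D∣ : t + ℓ ≡ ∣ D ∣
    t+ℓ≡∣D∣ = m∸n+n≡m (≤-trans (m≤n*m ℓ 2) (<⇒≤ ∣∁W∣>2ℓ))

    ℓ<t : ℓ < t
    ℓ<t = +-cancelʳ-≤ ℓ (suc ℓ) t (begin
      suc ℓ + ℓ     ≡⟨ solve (ℓ ∷ []) ⟩
      suc (2 * ℓ)   ≤⟨ ∣∁W∣>2ℓ ⟩
      ∣ D ∣         ≡⟨ t+ℓ≡∣D∣ ⟨
      t + ℓ         ∎)
      where open ≤-Reasoning

    heavy? : ∀ x → Dec (t ≤ ∣ D ∩ N red x ∣)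
    heavy? x = t ≤? ∣ D ∩ N red x ∣

    X : Subset n
    X = W ∩ toSubset heavy?

    X⊆W : X ⊆ W
    X⊆W = p∩q⊆p W _

    heavy : ∀ {x} → x ∈ X → t ≤ ∣ D ∩ N red x ∣
    heavy x∈X = ∈toSubset⁻ heavy? (proj₂ (x∈p∩q⁻ W _ x∈X))

    ∣X∣≤2ℓ : ∣ X ∣ ≤ 2 * ℓ
    ∣X∣≤2ℓ = x*t≤[t+ℓ]*ℓ⇒x≤2ℓ ℓ<t (subst (λ d → ∣ X ∣ * t ≤ d * ℓ) (sym t+ℓ≡∣D∣)
      (double-counting red heavy λ a∈D → ≤-trans (p⊆q⇒∣p∩r∣≤∣q∩r∣ (N red _) X⊆W) (sparse (x∈∁p⇒x∉p a∈D))))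

    removed : ∣ ∁ (∁ X) ∣ ≤ 2 * ℓ
    removed = ≤-trans (p⊆q⇒∣p∣≤∣q∣ (∁∁p⊆p {p = X})) ∣X∣≤2ℓ

    D⊆∁X : D ⊆ ∁ X
    D⊆∁X a∈D = x∉p⇒x∈∁p (x∈∁p⇒x∉p a∈D ∘ X⊆W)

    near-core : ∀ {x} → x ∈ ∁ X → x ∈ D ⊎ suc ℓ ≤ ∣ D ∩ N blue x ∣
    near-core {x} x∈∁X with x ∈? W
    ... | no  x∉W = inj₁ (x∉p⇒x∈∁p x∉W)
    ... | yes x∈W = inj₂ (+-cancelˡ-≤ ∣ D ∩ N red x ∣ _ _ (begin
      ∣ D ∩ N red x ∣ + suc ℓ                      ≡⟨ +-suc _ ℓ ⟩
      suc ∣ D ∩ N red x ∣ + ℓ                      ≤⟨ +-monoˡ-≤ ℓ light ⟩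
      t + ℓ                                        ≡⟨ t+ℓ≡∣D∣ ⟩
      ∣ D ∣                                        ≤⟨ ∣p∣≤∣p∩N∣+∣p∩N-complement∣ (x∈p⇒x∉∁p x∈W) ⟩
      ∣ D ∩ N red x ∣ + ∣ D ∩ N blue x ∣           ∎))
      where
      open ≤-Reasoning
      light : ∣ D ∩ N red x ∣ < t
      light = ≰⇒> λ t≤ → x∈∁p⇒x∉p x∈∁X (x∈p∩q⁺ (x∈W , ∈toSubset⁺ heavy? t≤))

    core-linked : ∀ {a b} → a ∈ D → b ∈ D → a ≢ b →
      adj blue a b ≡ true ⊎ suc ℓ ≤ ∣ ∁ X ∩ N blue a ∩ N blue b ∣
    core-linked {a} {b} a∈D b∈D _ = inj₂ (+-cancelʳ-≤ (4 * ℓ) (suc ℓ) _ (begin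
      suc ℓ + 4 * ℓ                                          ≤⟨ m≤m+n _ 1 ⟩
      suc ℓ + 4 * ℓ + 1                                      ≡⟨ solve (ℓ ∷ []) ⟩
      5 * ℓ + 2                                              ≤⟨ 5ℓ+2≤∣W∣ {W} ∣∁W∣≤3ℓ ⟩
      ∣ W ∣                                                  ≤⟨ p⊆q∪r⇒∣p∣≤∣q∣+∣r∣ split ⟩
      ∣ C ∣ + ∣ X ∪ Ra ∪ Rb ∣                                 ≤⟨ +-monoʳ-≤ ∣ C ∣ (≤-trans (∣p∪q∣≤∣p∣+∣q∣ X _) (+-monoʳ-≤ ∣ X ∣ (∣p∪q∣≤∣p∣+∣q∣ Ra Rb))) ⟩
      ∣ C ∣ + (∣ X ∣ + (∣ Ra ∣ + ∣ Rb ∣))                    ≤⟨ +-monoʳ-≤ ∣ C ∣ (+-mono-≤ ∣X∣≤2ℓ (+-mono-≤ (sparse a∉W) (sparse b∉W))) ⟩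
      ∣ C ∣ + (2 * ℓ + (ℓ + ℓ))                              ≡⟨ cong (∣ C ∣ +_) (solve (ℓ ∷ [])) ⟩
      ∣ C ∣ + 4 * ℓ                                          ∎))
      where
      open ≤-Reasoning
      a∉W : a ∉ W
      a∉W = x∈∁p⇒x∉p a∈D
      b∉W : b ∉ W
      b∉W = x∈∁p⇒x∉p b∈D
      C Ra Rb : Subset n
      C  = ∁ X ∩ N blue a ∩ N blue b
      Ra = W ∩ N red a
      Rb = W ∩ N red b
      split : W ⊆ C ∪ X ∪ Ra ∪ Rb
      split {y} y∈W with y ∈? X | y ∈? N red a | y ∈? N red b
      ... | yes y∈X | _        | _        = x∈p∪q⁺ (inj₂ (x∈p∪q⁺ (inj₁ y∈X)))
      ... | no  _   | yes y∈Na | _        = x∈p∪q⁺ (inj₂ (x∈p∪q⁺ (inj₂ (x∈p∪q⁺ (inj₁ (x∈p∩q⁺ (y∈W , y∈Na)))))))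
      ... | no  _   | no  _    | yes y∈Nb = x∈p∪q⁺ (inj₂ (x∈p∪q⁺ (inj₂ (x∈p∪q⁺ (inj₂ (x∈p∩q⁺ (y∈W , y∈Nb)))))))
      ... | no  y∉X | no  y∉Na | no  y∉Nb = x∈p∪q⁺ (inj₁ (x∈p∩q⁺ (x∉p⇒x∈∁p y∉X ,
              x∈p∩q⁺ (∉N⇒∈N-complement (λ { refl → a∉W y∈W }) y∉Na , ∉N⇒∈N-complement (λ { refl → b∉W y∈W }) y∉Nb))))

  module _ {W : Subset n} (sep : Separation (suc ℓ) red W) where
    open Separation sep

    balanced-or-small-side : (suc ℓ ≤ ∣ A ∣ × suc ℓ ≤ ∣ B ∣) ⊎ ∃ λ (sep′ : Separation (suc ℓ) red W) → ∣ Separation.A sep′ ∣ ≤ ℓ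
    balanced-or-small-side with suc ℓ ≤? ∣ A ∣ | suc ℓ ≤? ∣ B ∣
    ... | yes ∣A∣>ℓ | yes ∣B∣>ℓ = inj₁ (∣A∣>ℓ , ∣B∣>ℓ)
    ... | no  ∣A∣≯ℓ | _         = inj₂ (sep , ≤-pred (≰⇒> ∣A∣≯ℓ))
    ... | yes _     | no  ∣B∣≯ℓ = inj₂ (swap , ≤-pred (≰⇒> ∣B∣≯ℓ))

    pruned⊂ : W ─ A ⊂ W
    pruned⊂ = let a , a∈A = A-nonempty in p∩q≢∅⇒p─q⊂p W A (a , x∈p∩q⁺ (p─q⊆p W S (A⊆W─S a∈A) , a∈A))

    pruned-removed : ∣ ∁ W ∣ ≤ 2 * ℓ → ∣ A ∣ ≤ ℓ → ∣ ∁ (W ─ A) ∣ ≤ 3 * ℓ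
    pruned-removed ∣∁W∣≤2ℓ ∣A∣≤ℓ = begin
      ∣ ∁ (W ─ A) ∣      ≤⟨ ∣∁[p─q]∣≤∣∁p∣+∣q∣ W A ⟩
      ∣ ∁ W ∣ + ∣ A ∣    ≤⟨ +-mono-≤ ∣∁W∣≤2ℓ ∣A∣≤ℓ ⟩
      2 * ℓ + ℓ          ≡⟨ solve (ℓ ∷ []) ⟩
      3 * ℓ              ∎
      where open ≤-Reasoning

    pruned-sparse : Sparse W → Sparse (W ─ A)
    pruned-sparse sparse {a} a∉W─A with a ∈? W
    ... | no  a∉W = ≤-trans (p⊆q⇒∣p∩r∣≤∣q∩r∣ (N red a) (p─q⊆p W A)) (sparse a∉W)
    ... | yes a∈W = ≤-trans (p⊆q⇒∣p∣≤∣q∣ red-neighbours⊆S) (≤-pred ∣S∣<k)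
      where
      a∈A : a ∈ A
      a∈A with a ∈? A
      ... | yes a∈A = a∈A
      ... | no  a∉A = contradiction (x∈p∧x∉q⇒x∈p─q a∈W a∉A) a∉W─A
      red-neighbours⊆S : (W ─ A) ∩ N red a ⊆ S
      red-neighbours⊆S {y} y∈ with x∈p∩q⁻ (W ─ A) _ y∈
      ... | y∈W─A , y∈Na with y ∈? S
      ... | yes y∈S = y∈S
      ... | no  y∉S with x∈p∪q⁻ A B (W─S⊆A∪B (x∈p∧x∉q⇒x∈p─q (p─q⊆p W A y∈W─A) y∉S))
      ... | inj₁ y∈A = contradiction y∈A (x∈p─q⇒x∉q y∈W─A)
      ... | inj₂ y∈B = contradiction y∈Na (∉N⁺ (no-edge a∈A y∈B))

  search : ∀ {W} → Acc _⊂_ W → ∣ ∁ W ∣ ≤ 2 * ℓ → Sparse W → LargeKConnected red ⊎ LargeKConnected blue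
  search {W} (acc smaller) few-removed sparse with kConnected-or-separation red (ℓ+2≤∣W∣ {W} few-removed)
  ... | inj₁ connected = inj₁ (W , connected , few-removed)
  ... | inj₂ sep with balanced-or-small-side sep
  ... | inj₁ (∣A∣>ℓ , ∣B∣>ℓ) = inj₂ (blue-of-balanced-separation few-removed sparse sep ∣A∣>ℓ ∣B∣>ℓ)
  ... | inj₂ (sep′ , ∣A∣≤ℓ) with ∣ ∁ (W ─ Separation.A sep′) ∣ ≤? 2 * ℓ
  ... | yes few  = search (smaller (pruned⊂ sep′)) few (pruned-sparse sep′ sparse)
  ... | no  many = inj₂ (blue-of-moderate-removal (pruned-sparse sep′ sparse) (≰⇒> many)
                                                  (pruned-removed sep′ few-removed ∣A∣≤ℓ))

  red-or-blue : LargeKConnected red ⊎ LargeKConnected blue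
  red-or-blue = search (⊂-wellFounded ⊤) nothing-removed (λ a∉⊤ → contradiction ∈⊤ a∉⊤)
    where
    nothing-removed : ∣ ∁ (⊤ {n}) ∣ ≤ 2 * ℓ
    nothing-removed = begin
      ∣ ∁ (⊤ {n}) ∣    ≤⟨ p⊆q⇒∣p∣≤∣q∣ {p = ∁ (⊤ {n})} {q = ⊥} (contradiction ∈⊤ ∘ x∈∁p⇒x∉p) ⟩
      ∣ ⊥ {n} ∣        ≡⟨ ∣⊥∣≡0 n ⟩
      0                ≤⟨ z≤n ⟩
      2 * ℓ            ∎
      where open ≤-Reasoning

-- Colour classes

anyFin-witness : ∀ (p : Fin n → Bool) → anyFin p ≡ true → ∃ λ i → p i ≡ true
anyFin-witness {suc n} p any-p with p zero in p0
... | true  = zero , p0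
... | false = let i , pi = anyFin-witness (λ i → p (suc i)) any-p in suc i , pi

numColours≤∣C∣ : ∀ {r} (f : Colouring n r) H C → (∀ {i j} → E H i j ≡ true → f i j ∈ C) → numColours f H ≤ ∣ C ∣
numColours≤∣C∣ {n} {r} f H C edge-in-C = p⊆q⇒∣p∣≤∣q∣ colourSet⊆C
  where
  coloured : Fin r → Fin n → Fin n → Bool
  coloured c i j = E H i j ∧ ⌊ f i j ≟ c ⌋

  colourSet⊆C : colourSet f H ⊆ C
  colourSet⊆C {c} c∈ with anyFin-witness (λ i → anyFin (coloured c i)) (x∈tabulate⁻ c∈)
  ... | i , used-at-i with anyFin-witness (coloured c i) used-at-i
  ... | j , used-at-ij = subst (_∈ C) (colour≡ (∧-conicalʳ _ _ used-at-ij)) (edge-in-C (∧-conicalˡ _ _ used-at-ij))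
    where
    colour≡ : ⌊ f i j ≟ c ⌋ ≡ true → f i j ≡ c
    colour≡ _ with f i j ≟ c
    ... | yes fij≡c = fij≡c

∣tabulate[toℕ<ᵇ]∣≡⊓ : ∀ m s → ∣ tabulate {n = m} (λ c → toℕ c <ᵇ s) ∣ ≡ m ⊓ s
∣tabulate[toℕ<ᵇ]∣≡⊓ zero    s       = refl
∣tabulate[toℕ<ᵇ]∣≡⊓ (suc m) zero    = trans (∣tabulate[toℕ<ᵇ]∣≡⊓ m zero) (⊓-zeroʳ m)
∣tabulate[toℕ<ᵇ]∣≡⊓ (suc m) (suc s) = cong suc (∣tabulate[toℕ<ᵇ]∣≡⊓ m s)

module ColourHalves {n : ℕ} (s : ℕ) (f : Colouring n (2 * s)) (f-sym : SymmetricColouring f) where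

  lowColours : Subset (2 * s)
  lowColours = tabulate λ c → toℕ c <ᵇ s

  ∣lowColours∣≡s : ∣ lowColours ∣ ≡ s
  ∣lowColours∣≡s = trans (∣tabulate[toℕ<ᵇ]∣≡⊓ (2 * s) s) (m≥n⇒m⊓n≡n (m≤n*m s 2))

  ∣∁lowColours∣≡s : ∣ ∁ lowColours ∣ ≡ s
  ∣∁lowColours∣≡s = begin
    ∣ ∁ lowColours ∣         ≡⟨ ∣∁p∣≡n∸∣p∣ lowColours ⟩
    2 * s ∸ ∣ lowColours ∣   ≡⟨ cong (2 * s ∸_) ∣lowColours∣≡s ⟩
    s + (s + 0) ∸ s          ≡⟨ m+n∸m≡n s (s + 0) ⟩
    s + 0                    ≡⟨ +-identityʳ s ⟩
    s                        ∎
    where open ≡-Reasoning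

  lowEdge : Fin n → Fin n → Bool
  lowEdge i j = toℕ (f i j) <ᵇ s

  lowEdge-sym : ∀ i j → lowEdge i j ≡ lowEdge j i
  lowEdge-sym i j = cong (λ c → toℕ c <ᵇ s) (f-sym i j)

  red : Graph n
  red = loopless lowEdge lowEdge-sym

  red-colours : ∀ {i j} → adj red i j ≡ true → f i j ∈ lowColours
  red-colours red-ij = x∈tabulate⁺ (∧-conicalʳ _ _ red-ij)

  blue-colours : ∀ {i j} → adj (complement red) i j ≡ true → f i j ∈ ∁ lowColours
  blue-colours blue-ij = x∉p⇒x∈∁p λ fij∈low →
    Bool.not-¬ (loopless-adj⁺ lowEdge lowEdge-sym (adj⇒≢ (complement red) blue-ij) (x∈tabulate⁻ fij∈low))
               (complement-adj⁻ {G = red} blue-ij)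

8ℓ+2≤n : ∀ {n} ℓ → 2 ≤ n → 13 * suc ℓ ≤ n + 15 → 8 * ℓ + 2 ≤ n
8ℓ+2≤n zero    2≤n _ = 2≤n
8ℓ+2≤n (suc m) _   h = +-cancelʳ-≤ 15 _ _ (begin
  8 * suc m + 2 + 15                  ≤⟨ m≤m+n _ (5 * m + 1) ⟩
  8 * suc m + 2 + 15 + (5 * m + 1)    ≡⟨ solve (m ∷ []) ⟩
  13 * suc (suc m)                    ≤⟨ h ⟩
  _ + 15                              ∎)
  where open ≤-Reasoning

n+2≤∣W∣+2[1+ℓ] : ∀ {n ℓ} (W : Subset n) → ∣ ∁ W ∣ ≤ 2 * ℓ → n + 2 ≤ ∣ W ∣ + 2 * suc ℓ
n+2≤∣W∣+2[1+ℓ] {n} {ℓ} W ∣∁W∣≤2ℓ = begin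
  n + 2                      ≡⟨ cong (_+ 2) (∣p∣+∣∁p∣≡n W) ⟨
  ∣ W ∣ + ∣ ∁ W ∣ + 2        ≤⟨ +-monoˡ-≤ 2 (+-monoʳ-≤ ∣ W ∣ ∣∁W∣≤2ℓ) ⟩
  ∣ W ∣ + 2 * ℓ + 2          ≡⟨ +-assoc ∣ W ∣ (2 * ℓ) 2 ⟩
  ∣ W ∣ + (2 * ℓ + 2)        ≡⟨ cong (∣ W ∣ +_) (solve (ℓ ∷ [])) ⟩
  ∣ W ∣ + 2 * suc ℓ          ∎
  where open ≤-Reasoning

lemma4p1 : (n s k : ℕ) → 2 ≤ n → 1 ≤ k → 13 * k ≤ n + 15 →
    (f : Colouring n (2 * s)) → SymmetricColouring f →
    Σ (Subgraph n) λ H →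
      KConnected k H × numColours f H ≤ s × n + 2 ≤ ∣ V H ∣ + 2 * k
lemma4p1 n s zero    _   ()
lemma4p1 n s (suc ℓ) 2≤n _ 13k≤n+15 f f-sym =
  [ subgraph red lowColours red-colours ∣lowColours∣≡s
  , subgraph (complement red) (∁ lowColours) blue-colours ∣∁lowColours∣≡s
  ]′ red-or-blue
  where
  open ColourHalves s f f-sym
  open BollobasGyarfas ℓ red (8ℓ+2≤n ℓ 2≤n 13k≤n+15)

  subgraph : ∀ G C → (∀ {i j} → adj G i j ≡ true → f i j ∈ C) → ∣ C ∣ ≡ s → LargeKConnected G →
    Σ (Subgraph n) λ H → KConnected (suc ℓ) H × numColours f H ≤ s × n + 2 ≤ ∣ V H ∣ + 2 * suc ℓ
  subgraph G C G-colours ∣C∣≡s (W , connected , few-removed) =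
    induced G W , connected ,
    ≤-trans (numColours≤∣C∣ f (induced G W) C (G-colours ∘ induced-edge⁻ G W)) (≤-reflexive ∣C∣≡s) ,
    n+2≤∣W∣+2[1+ℓ] W few-removed
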